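{- Let $(A,\sqcup,\underline{\phantom{a}}[\underline{\phantom{a}}])$ be an algebra satisfying: $\sqcup$ is associative and idempotent; $x=x[x\sqcup y]$; $x\sqcup y=y[x]\sqcup x$; $x[y][z]=x[z\sqcup y]$; $(x\sqcup y)[z]=x[z]\sqcup y[z]$; $x[y[x[z]]]=x[y[x][z]]$; $w[x[y[w[z]]]]=w[x[y[w][z]]]$. Then for all $u,v,w,x,y,z\in A$: (i) $x[y][z]=x[z][y[z]]$; (ii) if $x[y]=x$ then $y[x]=y$; (iii) if $x\sqcup z=z$ and $y\sqcup z=z$ then $x[y]=x$; (iv) if $x\sqcup y=x$ and $y\sqcup x=y$ then $x[u][y]=y$; (v) if $x\sqcup y=x$, $y\sqcup x=y$ and $v\sqcup x=v\sqcup y$, then $u[x][v[y][w]]=u[y][v[y][w]]$.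
   Context: Convention: $u[v][w]$ means $(u[v])[w]$; the operations are abstract binary operations on the set $A$. -}

module Defs where

open import Level using (Level; suc)
open import Relation.Binary.PropositionalEquality using (_≡_)

record Alg (a : Level) : Set (suc a) where
  infixl 7 _[_]
  infixr 6 _⊔_
  field
    A      : Set a
    _⊔_    : A → A → A
    _[_]   : A → A → A
    ⊔-assoc : ∀ x y z → (x ⊔ y) ⊔ z ≡ x ⊔ (y ⊔ z)
    ⊔-idem  : ∀ x → x ⊔ x ≡ x
    ax1 : ∀ x y → x ≡ x [ x ⊔ y ]
    ax2 : ∀ x y → x ⊔ y ≡ (y [ x ]) ⊔ x
    ax3 : ∀ x y z → x [ y ] [ z ] ≡ x [ z ⊔ y ]
    ax4 : ∀ x y z → (x ⊔ y) [ z ] ≡ (x [ z ]) ⊔ (y [ z ])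
    ax5 : ∀ x y z → x [ y [ x [ z ] ] ] ≡ x [ y [ x ] [ z ] ]
    ax6 : ∀ w x y z → w [ x [ y [ w [ z ] ] ] ] ≡ w [ x [ y [ w ] [ z ] ] ]

module Submission where

-- Everything follows by equational reasoning from the axioms ax1–ax4.  Three observations do most of the work:
--   * ax3 turns iterated substitution x [ y ] [ z ] into a single one,
--     x [ z ⊔ y ], so questions about substitution become questions
--     about joins in the argument;
--   * ax1 says x [ z ] = x whenever z is above x (x ⊔ z = z);
--   * ax2 lets us commute a join y ⊔ x once we know y [ x ] = y.
-- Part (i) is ax3 combined with ax2.  Part (iii) uses that x [ z ] = x for an upper bound z.
-- Part (iv) follows from (i) once we show x [ y ] = y for mutually
-- absorbing x, y.  Part (v) holds because v [ y ] [ w ] is above v, so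
-- the hypothesis v ⊔ x = v ⊔ y transfers to it.

open import Defs
open import Level using (Level)
open import Data.Product using (_×_; _,_)
open import Relation.Binary.PropositionalEquality
  using (_≡_; sym; trans; cong; module ≡-Reasoning)
open ≡-Reasoning

module Properties {a : Level} (𝔄 : Alg a) where
  open Alg 𝔄

  ⊔-absorbˡ : ∀ x y → x ⊔ (x ⊔ y) ≡ x ⊔ y
  ⊔-absorbˡ x y = trans (sym (⊔-assoc x x y)) (cong (_⊔ y) (⊔-idem x))

  subst-upper : ∀ x z → x ⊔ z ≡ z → x [ z ] ≡ x
  subst-upper x z h = sym (trans (ax1 x z) (cong (x [_]) h))

  subst-idem : ∀ x y → x [ y ] [ y ] ≡ x [ y ]
  subst-idem x y = trans (ax3 x y y) (cong (x [_]) (⊔-idem y))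

  ⊔-comm-if-fixed : ∀ x y → x [ y ] ≡ x → y ⊔ x ≡ x ⊔ y
  ⊔-comm-if-fixed x y h = trans (ax2 y x) (cong (_⊔ y) h)

  subst-subst : ∀ x y z → x [ y ] [ z ] ≡ x [ z ] [ y [ z ] ]
  subst-subst x y z = begin
    x [ y ] [ z ]          ≡⟨ ax3 x y z ⟩
    x [ z ⊔ y ]            ≡⟨ cong (x [_]) (ax2 z y) ⟩
    x [ y [ z ] ⊔ z ]      ≡⟨ sym (ax3 x z (y [ z ])) ⟩
    x [ z ] [ y [ z ] ]    ∎

  fixed-sym : ∀ x y → x [ y ] ≡ x → y [ x ] ≡ y
  fixed-sym x y h = begin
    y [ x ]                ≡⟨ cong (_[ x ]) (ax1 y x) ⟩
    y [ y ⊔ x ] [ x ]      ≡⟨ ax3 y (y ⊔ x) x ⟩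
    y [ x ⊔ (y ⊔ x) ]      ≡⟨ cong (λ t → y [ x ⊔ t ]) comm ⟩
    y [ x ⊔ (x ⊔ y) ]      ≡⟨ cong (y [_]) (⊔-absorbˡ x y) ⟩
    y [ x ⊔ y ]            ≡⟨ cong (y [_]) (sym comm) ⟩
    y [ y ⊔ x ]            ≡⟨ sym (ax1 y x) ⟩
    y                      ∎
    where
    comm : y ⊔ x ≡ x ⊔ y
    comm = ⊔-comm-if-fixed x y h

  fixed-by-common-upper : ∀ x y z → x ⊔ z ≡ z → y ⊔ z ≡ z → x [ y ] ≡ x
  fixed-by-common-upper x y z hx hy = begin
    x [ y ]                ≡⟨ cong (_[ y ]) (sym (subst-upper x z hx)) ⟩
    x [ z ] [ y ]          ≡⟨ ax3 x z y ⟩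
    x [ y ⊔ z ]            ≡⟨ cong (x [_]) hy ⟩
    x [ z ]                ≡⟨ subst-upper x z hx ⟩
    x                      ∎

  fixed-by-subst : ∀ a b → a [ b [ a ] ] ≡ a
  fixed-by-subst a b = fixed-sym (b [ a ]) a (subst-idem b a)

  subst-mutual : ∀ x y → x ⊔ y ≡ x → y ⊔ x ≡ y → x [ y ] ≡ y
  subst-mutual x y hxy hyx = begin
    x [ y ]                ≡⟨ expand ⟩
    y ⊔ x [ y ]            ≡⟨ ax2 y (x [ y ]) ⟩
    x [ y ] [ y ] ⊔ y      ≡⟨ cong (_⊔ y) (subst-idem x y) ⟩
    x [ y ] ⊔ y            ≡⟨ sym (ax2 y x) ⟩
    y ⊔ x                  ≡⟨ hyx ⟩
    y                      ∎
    where
    -- x = y [ x ] ⊔ x by ax2, and substituting y into y [ x ] returns y.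
    expand : x [ y ] ≡ y ⊔ x [ y ]
    expand = begin
      x [ y ]                  ≡⟨ cong (_[ y ]) (trans (sym hxy) (ax2 x y)) ⟩
      (y [ x ] ⊔ x) [ y ]      ≡⟨ ax4 (y [ x ]) x y ⟩
      y [ x ] [ y ] ⊔ x [ y ]  ≡⟨ cong (_⊔ x [ y ]) (trans (ax3 y x y) (sym (ax1 y x))) ⟩
      y ⊔ x [ y ]              ∎

  subst-mutual-after : ∀ x y u → x ⊔ y ≡ x → y ⊔ x ≡ y → x [ u ] [ y ] ≡ y
  subst-mutual-after x y u hxy hyx = begin
    x [ u ] [ y ]          ≡⟨ subst-subst x u y ⟩
    x [ y ] [ u [ y ] ]    ≡⟨ cong (_[ u [ y ] ]) (subst-mutual x y hxy hyx) ⟩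
    y [ u [ y ] ]          ≡⟨ fixed-by-subst y u ⟩
    y                      ∎

  subst-above : ∀ a s → a [ s ] ⊔ a ≡ a [ s ]
  subst-above a s = begin
    a [ s ] ⊔ a                  ≡⟨ cong (a [ s ] ⊔_) (trans (ax1 a s) (sym (ax3 a s a))) ⟩
    a [ s ] ⊔ a [ s ] [ a ]      ≡⟨ ax2 (a [ s ]) (a [ s ] [ a ]) ⟩
    a [ s ] [ a ] [ a [ s ] ] ⊔ a [ s ]
                                 ≡⟨ cong (_⊔ a [ s ]) (trans (ax3 (a [ s ]) a (a [ s ])) (sym (ax1 (a [ s ]) a))) ⟩
    a [ s ] ⊔ a [ s ]            ≡⟨ ⊔-idem (a [ s ]) ⟩
    a [ s ]                      ∎

  ⊔-cong-above : ∀ t v x y → t ⊔ v ≡ t → v ⊔ x ≡ v ⊔ y → t ⊔ x ≡ t ⊔ y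
  ⊔-cong-above t v x y htv h = begin
    t ⊔ x                  ≡⟨ cong (_⊔ x) (sym htv) ⟩
    (t ⊔ v) ⊔ x            ≡⟨ ⊔-assoc t v x ⟩
    t ⊔ (v ⊔ x)            ≡⟨ cong (t ⊔_) h ⟩
    t ⊔ (v ⊔ y)            ≡⟨ sym (⊔-assoc t v y) ⟩
    (t ⊔ v) ⊔ y            ≡⟨ cong (_⊔ y) htv ⟩
    t ⊔ y                  ∎

  -- Part (v).
  subst-agree : ∀ x y u v w → v ⊔ x ≡ v ⊔ y
              → u [ x ] [ v [ y ] [ w ] ] ≡ u [ y ] [ v [ y ] [ w ] ]
  subst-agree x y u v w h = begin
    u [ x ] [ t ]          ≡⟨ ax3 u x t ⟩
    u [ t ⊔ x ]            ≡⟨ cong (u [_]) (⊔-cong-above t v x y t-above-v h) ⟩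
    u [ t ⊔ y ]            ≡⟨ sym (ax3 u y t) ⟩
    u [ y ] [ t ]          ∎
    where
    t : A
    t = v [ y ] [ w ]
    t-above-v : t ⊔ v ≡ t
    t-above-v = begin
      t ⊔ v                ≡⟨ cong (_⊔ v) (ax3 v y w) ⟩
      v [ w ⊔ y ] ⊔ v      ≡⟨ subst-above v (w ⊔ y) ⟩
      v [ w ⊔ y ]          ≡⟨ sym (ax3 v y w) ⟩
      t                    ∎

lemma5p5 : ∀ {a : Level} (𝔄 : Alg a) → let open Alg 𝔄 in
    (∀ x y z → x [ y ] [ z ] ≡ x [ z ] [ y [ z ] ])
    × (∀ x y → x [ y ] ≡ x → y [ x ] ≡ y)
    × (∀ x y z → x ⊔ z ≡ z → y ⊔ z ≡ z → x [ y ] ≡ x)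
    × (∀ x y u → x ⊔ y ≡ x → y ⊔ x ≡ y → x [ u ] [ y ] ≡ y)
    × (∀ x y u v w → x ⊔ y ≡ x → y ⊔ x ≡ y → v ⊔ x ≡ v ⊔ y
    → u [ x ] [ v [ y ] [ w ] ] ≡ u [ y ] [ v [ y ] [ w ] ])
lemma5p5 𝔄 =
    subst-subst
  , fixed-sym
  , fixed-by-common-upper
  , subst-mutual-after
  , λ x y u v w _ _ → subst-agree x y u v w
  where open Properties 𝔄
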